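{- Let $G$ be a cubic (i.e., $3$-regular) graph of order $n$. Then $G$ is simply balanceable if and only if $n\equiv 0\pmod 4$.
   Context: All graphs are finite, simple and undirected. A graph $G=(V,E)$ is simply balanceable if there exists an independent set $I$ in $G$ such that $\lfloor |E|/2\rfloor \le \sum_{x\in I} d(x) \le \lceil |E|/2\rceil$, where $d(x)$ is the degree of $x$. -}

module Defs where

open import Data.Nat using (ℕ; zero; suc; _+_; _≤_; _<_; _/_; ⌊_/2⌋; ⌈_/2⌉)
open import Data.Bool using (Bool; true; false; if_then_else_)
open import Data.Fin using (Fin; toℕ) renaming (zero to fzero; suc to fsuc)
open import Data.Fin.Subset using (Subset; _∈_; inside)
open import Data.Vec using (lookup)
open import Data.Product using (Σ; _×_; _,_)
open import Relation.Binary.PropositionalEquality using (_≡_)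

Σ-fin : (n : ℕ) → (Fin n → ℕ) → ℕ
Σ-fin zero    f = 0
Σ-fin (suc n) f = f fzero + Σ-fin n (λ i → f (fsuc i))

record Graph (n : ℕ) : Set where
  field
    adj   : Fin n → Fin n → Bool
    sym   : ∀ i j → adj i j ≡ adj j i
    irrefl : ∀ i → adj i i ≡ false

open Graph public

indicator : Bool → ℕ
indicator true  = 1
indicator false = 0

degree : ∀ {n} → Graph n → Fin n → ℕ
degree {n} G x = Σ-fin n (λ y → indicator (adj G x y))

ltB : ℕ → ℕ → Bool
ltB zero    zero    = false
ltB zero    (suc _) = true
ltB (suc _) zero    = false
ltB (suc m) (suc k) = ltB m k

edgeCount : ∀ {n} → Graph n → ℕ
edgeCount {n} G =
  Σ-fin n (λ i → Σ-fin n (λ j →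
    indicator (if ltB (toℕ i) (toℕ j) then adj G i j else false)))

Cubic : ∀ {n} → Graph n → Set
Cubic {n} G = ∀ (x : Fin n) → degree G x ≡ 3

Independent : ∀ {n} → Graph n → Subset n → Set
Independent {n} G I = ∀ (x y : Fin n) → x ∈ I → y ∈ I → adj G x y ≡ false

degSum : ∀ {n} → Graph n → Subset n → ℕ
degSum {n} G I = Σ-fin n (λ x → if lookup I x then degree G x else 0)

SimplyBalanceable : ∀ {n} → Graph n → Set
SimplyBalanceable {n} G =
  Σ (Subset n) λ I → Independent G I ×
    (⌊ edgeCount G /2⌋ ≤ degSum G I × degSum G I ≤ ⌈ edgeCount G /2⌉)

-- In a cubic graph 2|E| = 3n, and an independent set I has degree sum 3|I|; so I balances
-- the graph exactly when 3|I| lies within 1/2 of 3n/4, i.e. when n = 4|I|.  Conversely, if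
-- 4 ∣ n, a greedily built maximal independent set T dominates every vertex, whence
-- n ≤ |T| + 3|T|, and any n/4 of its vertices form a balancing independent set.
module Submission where

open import Defs hiding (sym)
open import Data.Nat using (ℕ; _%_)
open import Function.Bundles using (_⇔_)
open import Relation.Binary.PropositionalEquality using (_≡_)

open import Data.Bool using (true; false; if_then_else_)
open import Data.Bool.Properties using (¬-not) renaming (_≟_ to _≟ᵇ_)
open import Data.Fin using (Fin; toℕ) renaming (zero to fzero; suc to fsuc)
open import Data.Fin.Properties using (toℕ-injective; any?)
open import Data.Fin.Subset using (Subset; ∣_∣; inside; outside; _∈_; _⊆_; ⊥; ⁅_⁆; _∪_)
open import Data.Fin.Subset.Properties
  using (_∈?_; ∉⊥; ⊥⊆; ∣⊥∣≡0; s⊆s; x∈p∪q⁻; x∈p∪q⁺; x∈⁅x⁆; x∈⁅y⁆⇒x≡y; q⊆p∪q)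
open import Data.List using (List; []; _∷_; allFin)
open import Data.List.Membership.Propositional.Properties using (∈-allFin)
open import Data.List.Relation.Unary.All as All using (All; []; _∷_)
open import Data.Nat using (zero; suc; _+_; _*_; _≤_; _<_; z≤n; s≤s; ⌊_/2⌋; ⌈_/2⌉)
open import Data.Nat.Divisibility using (_∣_; divides; m%n≡0⇔n∣m)
open import Data.Nat.Properties
open import Algebra.Properties.Semiring.Sum +-*-semiring
  using (sum; sum-cong-≗; sum-replicate-zero; ∑-distrib-+; ∑-comm)
open import Data.Nat.Tactic.RingSolver using (solve-∀)
open import Data.Product using (∃-syntax; _×_; _,_; map₁; map₂)
open import Data.Sum using (_⊎_; inj₁; inj₂) renaming (map to ⊎-map)
open import Data.Vec using ([]; _∷_; lookup)
open import Data.Vec.Properties using ([]=⇒lookup)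
open import Function.Base using (id; _∘_)
open import Function.Bundles using (Equivalence; mk⇔)
open import Function.Properties.Equivalence using () renaming (trans to ⇔-trans; sym to ⇔-sym)
open import Relation.Binary.Definitions using (tri<; tri≈; tri>)
open import Relation.Binary.PropositionalEquality
  using (refl; sym; trans; cong; cong₂; subst; module ≡-Reasoning)
open import Relation.Nullary using (¬_; Dec; yes; no; _×-dec_; contradiction)

Σ-fin≗sum : ∀ n (f : Fin n → ℕ) → Σ-fin n f ≡ sum f
Σ-fin≗sum zero    f = refl
Σ-fin≗sum (suc n) f = cong (f fzero +_) (Σ-fin≗sum n (f ∘ fsuc))

sum-mono-≤ : ∀ {n} {f g : Fin n → ℕ} → (∀ i → f i ≤ g i) → sum f ≤ sum g
sum-mono-≤ {zero}  f≤g = z≤n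
sum-mono-≤ {suc n} f≤g = +-mono-≤ (f≤g fzero) (sum-mono-≤ (f≤g ∘ fsuc))

f[i]≤sum : ∀ {n} (f : Fin n → ℕ) i → f i ≤ sum f
f[i]≤sum f fzero    = m≤m+n _ _
f[i]≤sum f (fsuc i) = ≤-trans (f[i]≤sum (f ∘ fsuc) i) (m≤n+m _ _)

sum-const : ∀ n k → sum {n} (λ _ → k) ≡ n * k
sum-const zero    k = refl
sum-const (suc n) k = cong (k +_) (sum-const n k)

⊆-of-size : ∀ {n} (p : Subset n) {m} → m ≤ ∣ p ∣ → ∃[ q ] q ⊆ p × ∣ q ∣ ≡ m
⊆-of-size {n} p {zero} _ = ⊥ , ⊥⊆ , ∣⊥∣≡0 n
⊆-of-size (inside ∷ p) {suc m} (s≤s m≤∣p∣) with q , q⊆p , ∣q∣≡m ← ⊆-of-size p m≤∣p∣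
  = inside ∷ q , s⊆s q⊆p , cong suc ∣q∣≡m
⊆-of-size (outside ∷ p) {suc m} m<∣p∣ with q , q⊆p , ∣q∣≡1+m ← ⊆-of-size p m<∣p∣
  = outside ∷ q , s⊆s q⊆p , ∣q∣≡1+m

restrict : ∀ {n} → Subset n → (Fin n → ℕ) → Fin n → ℕ
restrict I f x = if lookup I x then f x else 0

sum-restrict-const : ∀ {n d} (I : Subset n) {f : Fin n → ℕ} → (∀ x → f x ≡ d) →
                     sum (restrict I f) ≡ ∣ I ∣ * d
sum-restrict-const []            f≡d = refl
sum-restrict-const (inside ∷ I)  f≡d = cong₂ _+_ (f≡d fzero) (sum-restrict-const I (f≡d ∘ fsuc))
sum-restrict-const (outside ∷ I) f≡d = sum-restrict-const I (f≡d ∘ fsuc)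

ltB-< : ∀ {a b} → a < b → ltB a b ≡ true
ltB-< {zero}  {suc b} _         = refl
ltB-< {suc a} {suc b} (s≤s a<b) = ltB-< a<b

ltB-≥ : ∀ {a b} → b ≤ a → ltB a b ≡ false
ltB-≥ {zero}  {zero}  _         = refl
ltB-≥ {suc a} {zero}  _         = refl
ltB-≥ {suc a} {suc b} (s≤s b≤a) = ltB-≥ b≤a

module _ {n} (G : Graph n) where

  upper : Fin n → Fin n → ℕ
  upper i j = indicator (if ltB (toℕ i) (toℕ j) then adj G i j else false)

  adj≡upper+upperᵀ : ∀ i j → indicator (adj G i j) ≡ upper i j + upper j i
  adj≡upper+upperᵀ i j with <-cmp (toℕ i) (toℕ j)
  ... | tri< i<j _ _ rewrite ltB-< i<j | ltB-≥ (<⇒≤ i<j) = sym (+-identityʳ _)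
  ... | tri> _ _ j<i rewrite ltB-≥ (<⇒≤ j<i) | ltB-< j<i | Graph.sym G i j = refl
  ... | tri≈ _ i≡j _ rewrite toℕ-injective i≡j | ltB-≥ (≤-refl {toℕ j}) | irrefl G j = refl

  edgeCount≡∑∑upper : edgeCount G ≡ sum (sum ∘ upper)
  edgeCount≡∑∑upper = trans (Σ-fin≗sum n _) (sum-cong-≗ (λ i → Σ-fin≗sum n (upper i)))

  handshake : sum (degree G) ≡ edgeCount G + edgeCount G
  handshake = begin
    sum (degree G)                                   ≡⟨ sum-cong-≗ degree≡ ⟩
    sum (λ i → sum (λ j → upper i j + upper j i))    ≡⟨ sum-cong-≗ (λ i → ∑-distrib-+ (upper i) _) ⟩
    sum (λ i → sum (upper i) + sum (λ j → upper j i)) ≡⟨ ∑-distrib-+ (sum ∘ upper) _ ⟩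
    sum (sum ∘ upper) + sum (λ i → sum (λ j → upper j i))
                                                     ≡⟨ cong (sum (sum ∘ upper) +_) (∑-comm (λ i j → upper j i)) ⟩
    sum (sum ∘ upper) + sum (sum ∘ upper)            ≡⟨ cong₂ _+_ edgeCount≡∑∑upper edgeCount≡∑∑upper ⟨
    edgeCount G + edgeCount G                        ∎
    where
    open ≡-Reasoning
    degree≡ : ∀ i → degree G i ≡ sum (λ j → upper i j + upper j i)
    degree≡ i = trans (Σ-fin≗sum n _) (sum-cong-≗ (adj≡upper+upperᵀ i))

  Regular : ℕ → Set
  Regular d = ∀ x → degree G x ≡ d

  regular⇒edgeCount : ∀ {d} → Regular d → edgeCount G + edgeCount G ≡ n * d
  regular⇒edgeCount {d} reg = trans (sym handshake) (trans (sum-cong-≗ reg) (sum-const n d))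

  regular⇒degSum : ∀ {d} → Regular d → ∀ I → degSum G I ≡ ∣ I ∣ * d
  regular⇒degSum reg I = trans (Σ-fin≗sum n _) (sum-restrict-const I reg)

  HasNeighbourIn : Subset n → Fin n → Set
  HasNeighbourIn S y = ∃[ x ] x ∈ S × adj G x y ≡ true

  hasNeighbourIn? : ∀ S y → Dec (HasNeighbourIn S y)
  hasNeighbourIn? S y = any? λ x → x ∈? S ×-dec adj G x y ≟ᵇ true

  ¬HasNeighbourIn⇒nonadjacent : ∀ {S x y} → ¬ HasNeighbourIn S y → x ∈ S → adj G x y ≡ false
  ¬HasNeighbourIn⇒nonadjacent ¬nb x∈S = ¬-not λ a → ¬nb (_ , x∈S , a)

  DominatedBy : Subset n → Fin n → Set
  DominatedBy S y = y ∈ S ⊎ HasNeighbourIn S y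

  DominatedBy-⊆ : ∀ {S T y} → S ⊆ T → DominatedBy S y → DominatedBy T y
  DominatedBy-⊆ S⊆T = ⊎-map S⊆T (map₂ (map₁ S⊆T))

  independent-⊆ : ∀ {S T} → Independent G T → S ⊆ T → Independent G S
  independent-⊆ ind S⊆T x y x∈S y∈S = ind x y (S⊆T x∈S) (S⊆T y∈S)

  insert-independent : ∀ {S y} → Independent G S → ¬ HasNeighbourIn S y →
                       Independent G (⁅ y ⁆ ∪ S)
  insert-independent {S} {y} ind ¬nb x z x∈ z∈ with x∈p∪q⁻ ⁅ y ⁆ S x∈ | x∈p∪q⁻ ⁅ y ⁆ S z∈
  ... | inj₁ x∈⁅y⁆ | inj₁ z∈⁅y⁆
    rewrite x∈⁅y⁆⇒x≡y y x∈⁅y⁆ | x∈⁅y⁆⇒x≡y y z∈⁅y⁆ = irrefl G y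
  ... | inj₁ x∈⁅y⁆ | inj₂ z∈S
    rewrite x∈⁅y⁆⇒x≡y y x∈⁅y⁆ = trans (Graph.sym G y z) (¬HasNeighbourIn⇒nonadjacent ¬nb z∈S)
  ... | inj₂ x∈S | inj₁ z∈⁅y⁆
    rewrite x∈⁅y⁆⇒x≡y y z∈⁅y⁆ = ¬HasNeighbourIn⇒nonadjacent ¬nb x∈S
  ... | inj₂ x∈S | inj₂ z∈S = ind x z x∈S z∈S

  greedyStep : Subset n → Fin n → Subset n
  greedyStep S y with hasNeighbourIn? S y
  ... | yes _ = S
  ... | no  _ = ⁅ y ⁆ ∪ S

  greedyStep-⊇ : ∀ S y → S ⊆ greedyStep S y
  greedyStep-⊇ S y with hasNeighbourIn? S y
  ... | yes _ = id
  ... | no  _ = q⊆p∪q ⁅ y ⁆ S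

  greedyStep-dominates : ∀ S y → DominatedBy (greedyStep S y) y
  greedyStep-dominates S y with hasNeighbourIn? S y
  ... | yes nb = inj₂ nb
  ... | no  _  = inj₁ (x∈p∪q⁺ (inj₁ (x∈⁅x⁆ y)))

  greedyStep-independent : ∀ {S} y → Independent G S → Independent G (greedyStep S y)
  greedyStep-independent {S} y ind with hasNeighbourIn? S y
  ... | yes _  = ind
  ... | no ¬nb = insert-independent ind ¬nb

  greedy : List (Fin n) → Subset n
  greedy []       = ⊥
  greedy (y ∷ ys) = greedyStep (greedy ys) y

  greedy-independent : ∀ ys → Independent G (greedy ys)
  greedy-independent []       x y x∈⊥ _ = contradiction x∈⊥ ∉⊥
  greedy-independent (y ∷ ys) = greedyStep-independent y (greedy-independent ys)

  greedy-dominates : ∀ ys → All (DominatedBy (greedy ys)) ys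
  greedy-dominates []       = []
  greedy-dominates (y ∷ ys) =
    greedyStep-dominates (greedy ys) y ∷
    All.map (DominatedBy-⊆ (greedyStep-⊇ (greedy ys) y)) (greedy-dominates ys)

  maximal-independent : ∃[ S ] Independent G S × (∀ y → DominatedBy S y)
  maximal-independent =
    greedy (allFin n) , greedy-independent (allFin n) ,
    λ y → All.lookup (greedy-dominates (allFin n)) (∈-allFin y)

  dominating-size : ∀ {S} → (∀ y → DominatedBy S y) → n ≤ ∣ S ∣ + degSum G S
  dominating-size {S} dom = begin
    n                                                    ≡⟨ trans (sum-const n 1) (*-identityʳ n) ⟨
    sum one                                              ≤⟨ sum-mono-≤ covered ⟩
    sum (λ y → restrict S one y + sum (neighbourIn y))   ≡⟨ ∑-distrib-+ (restrict S one) _ ⟩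
    sum (restrict S one) + sum (sum ∘ neighbourIn)       ≡⟨ cong₂ _+_ (sum-restrict-const S (λ _ → refl))
                                                                      (∑-comm neighbourIn) ⟩
    ∣ S ∣ * 1 + sum (λ x → sum (λ y → neighbourIn y x))  ≡⟨ cong₂ _+_ (*-identityʳ ∣ S ∣) (sum-cong-≗ column) ⟩
    ∣ S ∣ + sum (restrict S (degree G))                  ≡⟨ cong (∣ S ∣ +_) (Σ-fin≗sum n _) ⟨
    ∣ S ∣ + degSum G S                                   ∎
    where
    open ≤-Reasoning
    one : Fin n → ℕ
    one _ = 1
    neighbourIn : Fin n → Fin n → ℕ
    neighbourIn y = restrict S (λ x → indicator (adj G x y))
    covered : ∀ y → 1 ≤ restrict S one y + sum (neighbourIn y)
    covered y with dom y
    ... | inj₁ y∈S rewrite []=⇒lookup y∈S = m≤m+n 1 _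
    ... | inj₂ (x , x∈S , x~y) = ≤-trans (subst (_≤ sum (neighbourIn y)) counted (f[i]≤sum (neighbourIn y) x))
                                         (m≤n+m _ _)
      where
      counted : neighbourIn y x ≡ 1
      counted rewrite []=⇒lookup x∈S | x~y = refl
    column : ∀ x → sum (λ y → neighbourIn y x) ≡ restrict S (degree G) x
    column x with lookup S x
    ... | true  = sym (Σ-fin≗sum n _)
    ... | false = sum-replicate-zero n

  regular-dominating-size : ∀ {d S} → Regular d → (∀ y → DominatedBy S y) → n ≤ ∣ S ∣ * suc d
  regular-dominating-size {d} {S} reg dom = begin
    n                    ≤⟨ dominating-size dom ⟩
    ∣ S ∣ + degSum G S   ≡⟨ cong (∣ S ∣ +_) (regular⇒degSum reg S) ⟩
    ∣ S ∣ + ∣ S ∣ * d    ≡⟨ *-suc ∣ S ∣ d ⟨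
    ∣ S ∣ * suc d        ∎
    where open ≤-Reasoning

  regular⇒independent-of-size : ∀ {d m} → Regular d → m * suc d ≤ n →
                                ∃[ I ] Independent G I × ∣ I ∣ ≡ m
  regular⇒independent-of-size {d} {m} reg m*[1+d]≤n
    with T , T-independent , T-dominating ← maximal-independent
    with I , I⊆T , ∣I∣≡m ← ⊆-of-size T (*-cancelʳ-≤ m ∣ T ∣ (suc d)
                             (≤-trans m*[1+d]≤n (regular-dominating-size reg T-dominating)))
    = I , independent-⊆ T-independent I⊆T , ∣I∣≡m

n≤1+⌊n/2⌋+⌊n/2⌋ : ∀ n → n ≤ suc (⌊ n /2⌋ + ⌊ n /2⌋)
n≤1+⌊n/2⌋+⌊n/2⌋ zero          = z≤n
n≤1+⌊n/2⌋+⌊n/2⌋ (suc zero)    = s≤s z≤n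
n≤1+⌊n/2⌋+⌊n/2⌋ (suc (suc n)) rewrite +-suc ⌊ n /2⌋ ⌊ n /2⌋ = s≤s (s≤s (n≤1+⌊n/2⌋+⌊n/2⌋ n))

⌈n/2⌉+⌈n/2⌉≤1+n : ∀ n → ⌈ n /2⌉ + ⌈ n /2⌉ ≤ suc n
⌈n/2⌉+⌈n/2⌉≤1+n zero          = z≤n
⌈n/2⌉+⌈n/2⌉≤1+n (suc zero)    = s≤s (s≤s z≤n)
⌈n/2⌉+⌈n/2⌉≤1+n (suc (suc n)) rewrite +-suc ⌈ n /2⌉ ⌈ n /2⌉ = s≤s (s≤s (⌈n/2⌉+⌈n/2⌉≤1+n n))

m*[1+k]≤k+n*[1+k]⇒m≤n : ∀ {m n} k → m * suc k ≤ k + n * suc k → m ≤ n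
m*[1+k]≤k+n*[1+k]⇒m≤n {m} {n} k le = ≤-pred (*-cancelʳ-< (suc k) m (suc n) (s≤s le))

+-double-injective : ∀ {m n} → m + m ≡ n + n → m ≡ n
+-double-injective {m} {n} eq = trans (n≡⌊n+n/2⌋ m) (trans (cong ⌊_/2⌋ eq) (sym (n≡⌊n+n/2⌋ n)))

⌊E/2⌋≤c*3≤⌈E/2⌉⇔n≡c*4 : ∀ {E n} c → E + E ≡ n * 3 →
                          (⌊ E /2⌋ ≤ c * 3 × c * 3 ≤ ⌈ E /2⌉) ⇔ n ≡ c * 4
⌊E/2⌋≤c*3≤⌈E/2⌉⇔n≡c*4 {E} {n} c E+E≡n*3 = mk⇔ to from
  where
  open ≤-Reasoning
  m*4*3≡ : ∀ m → m * 4 * 3 ≡ (m * 3 + m * 3) + (m * 3 + m * 3)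
  m*4*3≡ = solve-∀
  -- n * 3 and c * 4 * 3 are multiples of 3 at distance at most 2, hence equal.
  to : ⌊ E /2⌋ ≤ c * 3 × c * 3 ≤ ⌈ E /2⌉ → n ≡ c * 4
  to (lo , hi) = ≤-antisym (m*[1+k]≤k+n*[1+k]⇒m≤n 2 n*3≤) (m*[1+k]≤k+n*[1+k]⇒m≤n 2 c*4*3≤)
    where
    E≤ : E ≤ suc (c * 3 + c * 3)
    E≤ = ≤-trans (n≤1+⌊n/2⌋+⌊n/2⌋ E) (s≤s (+-mono-≤ lo lo))
    ≤E : c * 3 + c * 3 ≤ suc E
    ≤E = ≤-trans (+-mono-≤ hi hi) (⌈n/2⌉+⌈n/2⌉≤1+n E)
    n*3≤ : n * 3 ≤ 2 + c * 4 * 3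
    n*3≤ = begin
      n * 3   ≡⟨ E+E≡n*3 ⟨
      E + E   ≤⟨ +-mono-≤ E≤ E≤ ⟩
      suc (c * 3 + c * 3) + suc (c * 3 + c * 3) ≡⟨ cong suc (+-suc _ _) ⟩
      2 + ((c * 3 + c * 3) + (c * 3 + c * 3)) ≡⟨ cong (2 +_) (m*4*3≡ c) ⟨
      2 + c * 4 * 3 ∎
    c*4*3≤ : c * 4 * 3 ≤ 2 + n * 3
    c*4*3≤ = begin
      c * 4 * 3                               ≡⟨ m*4*3≡ c ⟩
      (c * 3 + c * 3) + (c * 3 + c * 3)       ≤⟨ +-mono-≤ ≤E ≤E ⟩
      suc E + suc E                           ≡⟨ cong suc (+-suc E E) ⟩
      2 + (E + E)                             ≡⟨ cong (2 +_) E+E≡n*3 ⟩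
      2 + n * 3                               ∎
  from : n ≡ c * 4 → ⌊ E /2⌋ ≤ c * 3 × c * 3 ≤ ⌈ E /2⌉
  from refl = ≤-reflexive (trans (cong ⌊_/2⌋ E≡) (sym (n≡⌊n+n/2⌋ (c * 3)))) ,
              ≤-reflexive (trans (n≡⌈n+n/2⌉ (c * 3)) (cong ⌈_/2⌉ (sym E≡)))
    where
    E≡ : E ≡ c * 3 + c * 3
    E≡ = +-double-injective (trans E+E≡n*3 (m*4*3≡ c))

cubic-balanceable⇔4∣n : ∀ {n} (G : Graph n) → Cubic G → SimplyBalanceable G ⇔ 4 ∣ n
cubic-balanceable⇔4∣n {n} G cubic = mk⇔ to from
  where
  balanced⇔ : ∀ I → (⌊ edgeCount G /2⌋ ≤ degSum G I × degSum G I ≤ ⌈ edgeCount G /2⌉) ⇔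
                    n ≡ ∣ I ∣ * 4
  balanced⇔ I rewrite regular⇒degSum G cubic I = ⌊E/2⌋≤c*3≤⌈E/2⌉⇔n≡c*4 ∣ I ∣ (regular⇒edgeCount G cubic)
  to : SimplyBalanceable G → 4 ∣ n
  to (I , _ , balanced) = divides ∣ I ∣ (Equivalence.to (balanced⇔ I) balanced)
  from : 4 ∣ n → SimplyBalanceable G
  from (divides q n≡q*4)
    with I , I-independent , ∣I∣≡q ← regular⇒independent-of-size G {m = q} cubic (≤-reflexive (sym n≡q*4))
    = I , I-independent , Equivalence.from (balanced⇔ I) (trans n≡q*4 (cong (_* 4) (sym ∣I∣≡q)))

corollary3p5 : (n : ℕ) (G : Graph n) → Cubic G →
    (SimplyBalanceable G ⇔ (n % 4 ≡ 0))
corollary3p5 n G cubic = ⇔-trans (cubic-balanceable⇔4∣n G cubic) (⇔-sym (m%n≡0⇔n∣m n 4))
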